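{- Let $X$ be a weighted sequence of length $n$, let $\frac1z$ be a threshold probability, let $\mathbf{X}$ be a fixed heavy string of $X$, and let $\mathcal{E}$ be the set of extensions of all solid factors of $X$. If $S\in\mathcal{E}$ and $S\neq\varepsilon$, then the longest proper suffix of $S$ also belongs to $\mathcal{E}$.
   Context: A weighted sequence $X=x_1\ldots x_n$ over an alphabet $\Sigma$ assigns to each position $i$ and letter $s\in\Sigma$ a probability $\pi_i(s)\ge0$ with $\sum_{s}\pi_i(s)=1$. A string $F$ (possibly empty) is a solid factor of $X$ starting at position $i$ and ending at position $j=i+|F|-1\le n$ if $\prod_{k=1}^{|F|}\pi_{i+k-1}(F[k])\ge\frac1z$. The heavy string $\mathbf{X}$ is obtained by choosing at each position a letter of maximum probability (ties broken arbitrarily, but fixed). The extension of a solid factor $F$ starting at $i$ and ending at $j\ge i-1$ is the string $F\,\mathbf{X}[j+1..n]$. $\varepsilon$ denotes the empty string.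
   Formalization: The probabilities $\pi_i(s)$ of the weighted sequence and the threshold $\frac1z$ take rational values. -}

module Defs where

open import Data.Nat using (ℕ; suc)
open import Data.Fin using (Fin)
open import Data.List using (List; []; _∷_; length; drop; map; sum; _++_; allFin)
open import Data.List.Relation.Unary.All using (All)
open import Data.List.Relation.Binary.Pointwise using (Pointwise)
open import Data.Rational using (ℚ; 0ℚ; 1ℚ; _*_; _≤_; 1/_; Positive)
open import Data.Rational.Properties using (pos⇒nonZero)
open import Data.Product using (Σ; _×_; ∃)
open import Relation.Binary.PropositionalEquality using (_≡_)
import Data.Nat as ℕ

sumℚ : List ℚ → ℚ
sumℚ [] = 0ℚ
sumℚ (q ∷ qs) = q Data.Rational.+ sumℚ qs

-- A weighted sequence over the alphabet Fin σ: a list of per-position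
-- distributions π_i : Fin σ → ℚ. Its length is n = length X. Positions are 0-indexed.
WSeq : ℕ → Set
WSeq σ = List (Fin σ → ℚ)

IsDistribution : ∀ {σ} → (Fin σ → ℚ) → Set
IsDistribution {σ} p = (∀ s → 0ℚ ≤ p s) × (sumℚ (map p (allFin σ)) ≡ 1ℚ)

ValidWSeq : ∀ {σ} → WSeq σ → Set
ValidWSeq X = All IsDistribution X

-- Probability of occurrence of string F aligned with the beginning of the
-- list of distributions: ∏_k π_k(F[k]) (0 if F runs past the end).
occProb : ∀ {σ} → WSeq σ → List (Fin σ) → ℚ
occProb _ [] = 1ℚ
occProb [] (_ ∷ _) = 0ℚ
occProb (p ∷ ps) (a ∷ F) = p a * occProb ps F

threshold : (z : ℚ) → .{{Positive z}} → ℚ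
threshold z {{pz}} = 1/_ z {{pos⇒nonZero z {{pz}}}}

SolidAt : ∀ {σ} → WSeq σ → (z : ℚ) → .{{Positive z}} → ℕ → List (Fin σ) → Set
SolidAt X z i F = (i ℕ.+ length F ℕ.≤ length X) × (threshold z ≤ occProb (drop i X) F)

IsHeavy : ∀ {σ} → WSeq σ → List (Fin σ) → Set
IsHeavy X H = Pointwise (λ p c → ∀ s → p s ≤ p c) X H

-- Extension of a solid factor F starting at i (ending at j = i+|F|-1):
-- F · H[j+1..n], i.e. F ++ drop (i + |F|) H.
extension : ∀ {σ} → List (Fin σ) → ℕ → List (Fin σ) → List (Fin σ)
extension H i F = F ++ drop (i ℕ.+ length F) H

InExt : ∀ {σ} → WSeq σ → (z : ℚ) → .{{Positive z}} → List (Fin σ) → List (Fin σ) → Set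
InExt X z H S = Σ ℕ λ i → Σ _ λ F → SolidAt X z i F × (S ≡ extension H i F)

module Submission where

-- Let a ∷ S be the extension F · H[i+|F|..] of a solid factor F starting at i.
-- * If F = b ∷ F', then S = F' · H[(i+1)+|F'|..] is the extension of F' at
--   i+1, and F' is solid there: its occurrence probability is that of b ∷ F'
--   with the factor π_i(b) removed, and π_i(b) ≤ 1 because it is an entry of
--   a distribution, so removing it cannot decrease the (nonnegative) product.
-- * If F = ε, then a ∷ S = H[i..], so S = H[i+1..] is the extension of ε at
--   i+1; ε is solid there because i+1 ≤ |H| = |X|, as H[i..] is nonempty.

open import Defs
open import Data.Nat using (ℕ)
open import Data.Fin using (Fin)
open import Data.List using (List; _∷_)
open import Data.Rational using (ℚ; Positive)

open import Data.List using ([]; length; drop; _++_)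
open import Data.List.Properties using (drop-drop; ∷-injectiveʳ)
open import Data.List.Relation.Unary.All using (All; []; _∷_; tabulate)
open import Data.List.Relation.Unary.All.Properties using (map⁺; drop⁺)
open import Data.List.Relation.Unary.Any using (here; there)
open import Data.List.Relation.Binary.Pointwise.Properties using (Pointwise-length)
open import Data.List.Membership.Propositional using (_∈_)
open import Data.List.Membership.Propositional.Properties using (∈-map⁺; ∈-allFin)
open import Data.Rational using (0ℚ; 1ℚ; _≤_; _*_; _+_; nonNegative)
import Data.Rational.Properties as ℚ
import Data.Nat as ℕ
import Data.Nat.Properties as ℕ
open import Data.Product using (_×_; _,_)
open import Relation.Binary.PropositionalEquality

sumℚ-nonNeg : ∀ {qs : List ℚ} → All (0ℚ ≤_) qs → 0ℚ ≤ sumℚ qs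
sumℚ-nonNeg [] = ℚ.≤-refl
sumℚ-nonNeg {q ∷ qs} (0≤q ∷ 0≤qs) =
  subst (_≤ q + sumℚ qs) (ℚ.+-identityʳ 0ℚ) (ℚ.+-mono-≤ 0≤q (sumℚ-nonNeg 0≤qs))

∈⇒≤sumℚ : ∀ {q : ℚ} {qs : List ℚ} → All (0ℚ ≤_) qs → q ∈ qs → q ≤ sumℚ qs
∈⇒≤sumℚ {q} {q ∷ qs} (_ ∷ 0≤qs) (here refl) =
  subst (_≤ q + sumℚ qs) (ℚ.+-identityʳ q) (ℚ.+-monoʳ-≤ q (sumℚ-nonNeg 0≤qs))
∈⇒≤sumℚ {q} {r ∷ qs} (0≤r ∷ 0≤qs) (there q∈qs) =
  subst (_≤ r + sumℚ qs) (ℚ.+-identityˡ q) (ℚ.+-mono-≤ 0≤r (∈⇒≤sumℚ 0≤qs q∈qs))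

distribution≤1 : ∀ {σ} {p : Fin σ → ℚ} → IsDistribution p → ∀ s → p s ≤ 1ℚ
distribution≤1 {σ} {p} (nonNeg , sum≡1) s =
  subst (p s ≤_) sum≡1
    (∈⇒≤sumℚ (map⁺ (tabulate (λ {t} _ → nonNeg t))) (∈-map⁺ p (∈-allFin s)))

occProb-nonNeg : ∀ {σ} {Y : WSeq σ} → ValidWSeq Y → ∀ F → 0ℚ ≤ occProb Y F
occProb-nonNeg _ [] = ℚ.nonNegative⁻¹ 1ℚ
occProb-nonNeg [] (_ ∷ _) = ℚ.≤-refl
occProb-nonNeg {Y = p ∷ ps} ((nonNeg , _) ∷ valid) (b ∷ F) =
  ℚ.nonNegative⁻¹ _ {{ℚ.nonNeg*nonNeg⇒nonNeg (p b) {{nonNegative (nonNeg b)}}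
                                              (occProb ps F) {{nonNegative (occProb-nonNeg valid F)}}}}

occProb-cons≤tail : ∀ {σ} {Y : WSeq σ} → ValidWSeq Y →
  ∀ b F → occProb Y (b ∷ F) ≤ occProb (drop 1 Y) F
occProb-cons≤tail [] _ F = occProb-nonNeg [] F
occProb-cons≤tail {Y = p ∷ ps} (distr ∷ valid) b F =
  subst (p b * occProb ps F ≤_) (ℚ.*-identityˡ (occProb ps F))
    (ℚ.*-monoʳ-≤-nonNeg (occProb ps F) {{nonNegative (occProb-nonNeg valid F)}}
      (distribution≤1 distr b))

drop-suc : ∀ {A : Set} (i : ℕ) (xs : List A) → drop 1 (drop i xs) ≡ drop (ℕ.suc i) xs
drop-suc i xs = trans (drop-drop i 1 xs) (cong (λ k → drop k xs) (ℕ.+-comm i 1))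

solid-tail : ∀ {σ} {X : WSeq σ} {z : ℚ} .{{_ : Positive z}} {i b F} → ValidWSeq X →
  SolidAt X z i (b ∷ F) → SolidAt X z (ℕ.suc i) F
solid-tail {X = X} {z} {i = i} {b} {F} valid (fits , solid) =
  subst (ℕ._≤ length X) (ℕ.+-suc i (length F)) fits ,
  subst (λ Y → threshold z ≤ occProb Y F) (drop-suc i X)
    (ℚ.≤-trans solid (occProb-cons≤tail (drop⁺ i valid) b F))

extension-cons : ∀ {σ} (H : List (Fin σ)) i b F →
  extension H i (b ∷ F) ≡ b ∷ extension H (ℕ.suc i) F
extension-cons H i b F = cong (λ k → b ∷ F ++ drop k H) (ℕ.+-suc i (length F))

drop≡∷⇒< : ∀ {A : Set} i (xs : List A) {a as} → drop i xs ≡ a ∷ as → i ℕ.< length xs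
drop≡∷⇒< ℕ.zero (_ ∷ _) _ = ℕ.s≤s ℕ.z≤n
drop≡∷⇒< (ℕ.suc i) (_ ∷ xs) eq = ℕ.s≤s (drop≡∷⇒< i xs eq)

empty-extension-tail : ∀ {σ} {X : WSeq σ} {z : ℚ} .{{_ : Positive z}} {H i a S} →
  IsHeavy X H → SolidAt X z i [] → a ∷ S ≡ extension H i [] →
  SolidAt X z (ℕ.suc i) [] × S ≡ extension H (ℕ.suc i) []
empty-extension-tail {X = X} {H = H} {i} heavy (_ , solid) eq =
  (subst (ℕ._≤ length X) (sym (ℕ.+-identityʳ (ℕ.suc i))) i<|X| , solid) ,
  trans (cong (drop 1) eq) (drop-suc (i ℕ.+ 0) H)
  where
  i<|X| : i ℕ.< length X
  i<|X| = subst (i ℕ.<_) (sym (Pointwise-length heavy))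
            (drop≡∷⇒< i H (trans (cong (λ k → drop k H) (sym (ℕ.+-identityʳ i))) (sym eq)))

mainTheorem2 : ∀ {σ : ℕ} (X : WSeq σ) (z : ℚ) .{{_ : Positive z}} (H : List (Fin σ)) →
    ValidWSeq X → IsHeavy X H →
    ∀ (a : Fin σ) (S : List (Fin σ)) → InExt X z H (a ∷ S) → InExt X z H S
mainTheorem2 X z H valid heavy a S (i , [] , solid , eq)
  with empty-extension-tail heavy solid eq
... | solid′ , eq′ = ℕ.suc i , [] , solid′ , eq′
mainTheorem2 X z H valid heavy a S (i , b ∷ F , solid , eq) =
  ℕ.suc i , F , solid-tail valid solid , ∷-injectiveʳ (trans eq (extension-cons H i b F))
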